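{- Let $K$ be a kind assignment, $T$ a type assignment and $M$ a term. If $\mathcal{W}(K,T,M)=(K',S,\tau)$, then $\tau$ is in normal form.
   Context: Types. Fix type variables $\alpha,\beta,\dots$, labels $l,\dots$ and finitely many base types $b$. $\tau ::= b\mid\rho\mid\tau\to\tau$; $\rho ::= \alpha\mid\{l_1:\tau_1,\dots,l_n:\tau_n\}\mid\rho+\{l:\tau\}\mid\rho-\{l:\tau\}$; $\sigma ::= \tau\mid\forall\alpha::k.\sigma$; $k ::= \mathcal{U}\mid\{\!\{l_1:\tau_1,\dots,l_n:\tau_n\,\|\,l'_1:\tau'_1,\dots,l'_m:\tau'_m\}\!\}$ (record kinds: left fields present, right fields absent). Labels within a record type or kind are pairwise distinct and unordered. Every extensible type is $\rho_0\pm_1\{l_1:\tau_1\}\cdots\pm_n\{l_n:\tau_n\}$ with $\rho_0=\mathrm{base}(\rho)$ a type variable or record type. $\mathrm{FTV}$ = free type variables ($\forall\alpha::k$ binds $\alpha$ in the body, not in $k$). A kind assignment $K$ is a finite map from type variables to kinds, well formed if $\mathrm{FTV}(K(\alpha))\subseteq\mathrm{dom}K$ for all $\alpha\in\mathrm{dom}K$; $K\{\alpha::k\}=K\cup\{\alpha::k\}$ with $\alpha\notin\mathrm{dom}K$. A type assignment $T$ is a finite map from term variables to polytypes; $T\{x:\sigma\}=T\cup\{x:\sigma\}$ with $x\notin\mathrm{dom}T$. Substitutions $S$ map finitely many type variables to types, are extended homomorphically to types, kinds ($S$ fieldwise) and type assignments (pointwise); $S_1\circ S_2$ applies $S_2$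 first; $\mathrm{id}$ is the identity. Kinding, respecting. $K\Vdash\tau::k$ is derivable by: (i) $K\Vdash\tau::\mathcal{U}$ for $\tau$ with $\mathrm{FTV}(\tau)\subseteq\mathrm{dom}K$; (ii) $K\Vdash\{l_1:\tau_1,\dots,l_n:\tau_n,\dots\}::\{\!\{l_1:\tau_1,\dots,l_n:\tau_n\|l'_1:\tau'_1,\dots,l'_m:\tau'_m\}\!\}$ if the $l'_j$ are not labels of the record and everything is well formed under $K$; (iii) $K\Vdash\alpha::\{\!\{F^l\|F^r\}\!\}$ if $K(\alpha)=\{\!\{F^l,\dots\|F^r,\dots\}\!\}$; (iv) $K\Vdash\rho+\{l:\tau\}::\{\!\{F^l,[l:\tau]\|F^r\}\!\}$ if $K\Vdash\rho::\{\!\{F^l\|F^r,l:\tau\}\!\}$; (v) $K\Vdash\rho-\{l:\tau\}::\{\!\{F^l\|F^r,[l:\tau]\}\!\}$ if $K\Vdash\rho::\{\!\{F^l,l:\tau\|F^r\}\!\}$ ($[l:\tau]$ optional). $(K_1,S)$ respects $K_2$ if $K_1\Vdash S(\alpha)::S(K_2(\alpha))$ for all $\alpha\in\mathrm{dom}K_2$. Normal forms. $\to$ rewrites extensible subterms by ("$\cdots$" = unchanged operations): (i) $\{l_1:\tau_1,\dots,l_i:\tau_i,\dots,l_n:\tau_n\}-\{l_i:\tau_i\}\cdots\to\{\text{the same fields without }l_i\}\cdots$; (ii) $\{l_1:\tau_1,\dots,l_n:\tau_n\}+\{l:\tau\}\cdots\to\{l_1:\tau_1,\dots,l_n:\tau_n,l:\tau\}\cdots$;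 (iii) $\alpha\pm_1\{l_1:\tau_1\}\cdots-_i\{l:\tau\}\cdots+_j\{l:\tau\}\cdots\to$ same with $i$-th and $j$-th operations deleted; (iv) likewise for $+_i\{l:\tau\}\cdots-_j\{l:\tau\}$; $i,j$ the first occurrences. The order of operations with different labels is insignificant. $\mathrm{nf}(\tau)$ is the unique normal form; a type is in normal form if irreducible. Unification. $\mathcal{U}(K,E)$, for $K$ a kind assignment and $E$ a set of pairs of monotypes, is the paper's kinded unification algorithm: it either fails or returns a kinded substitution $(K',S)$, which (by the paper's unification theorem) is a most general unifier, i.e. $(K',S)$ respects $K$, $\mathrm{nf}(S(\tau_1))=\mathrm{nf}(S(\tau_2))$ for all $(\tau_1,\tau_2)\in E$, and every other such $(K_3,S_2)$ factors as $S_2=S_3\circ S$ (up to normal forms) with $(K_3,S_3)$ respecting $K'$. Terms. $M ::= x\mid c^b\mid\lambda x.M\mid MM\mid\mathrm{let}\ x=M\ \mathrm{in}\ M\mid\{l_1=M_1,\dots,l_n=M_n\}\mid M.l\mid\mathrm{modify}(M,l,M)\mid M\setminus l\mid\mathrm{extend}(M,l,M)$. $\mathrm{EFTV}(K,\sigma)$ is the smallest set containing $\mathrm{FTV}(\sigma)$ and containing $\mathrm{FTV}(K(\alpha))$ whenever it contains $\alpha$; $\mathrm{EFTV}(K,T)=\bigcup_x\mathrm{EFTV}(K,T(x))$; $\mathrm{Cls}(K,T,\tau)=(K',\forall\alpha_1::k_1\cdots\forall\alpha_n::k_n.\tau)$ with $K'\{\alpha_1::k_1,\dots,\alpha_n::k_n\}=K$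 and $\{\alpha_1,\dots,\alpha_n\}=\mathrm{EFTV}(K,\tau)\setminus\mathrm{EFTV}(K,T)$. Algorithm $\mathcal{W}(K,T,M)$ (fails whenever $\mathcal{U}$ or a recursive call fails; introduced variables fresh): (1) $x$: fail if $x\notin\mathrm{dom}T$; else for $T(x)=\forall\alpha_1::k_1\cdots\forall\alpha_n::k_n.\tau$, $S=[\beta_1/\alpha_1,\dots,\beta_n/\alpha_n]$, return $(K\{\beta_1::S(k_1),\dots,\beta_n::S(k_n)\},\mathrm{id},\mathrm{nf}(S(\tau)))$. (2) $\lambda x.M$: $(K_1,S_1,\tau_1)=\mathcal{W}(K\{\alpha::\mathcal{U}\},T\{x:\alpha\},M)$; return $(K_1,S_1,\mathrm{nf}(S_1(\alpha))\to\tau_1)$. (3) $M_1M_2$: $(K_1,S_1,\tau_1)=\mathcal{W}(K,T,M_1)$; $(K_2,S_2,\tau_2)=\mathcal{W}(K_1,S_1(T),M_2)$; $(K_3,S_3)=\mathcal{U}(K_2\{\alpha::\mathcal{U}\},\{(S_2(\tau_1),\tau_2\to\alpha)\})$; return $(K_3,S_3\circ S_2\circ S_1,\mathrm{nf}(S_3(\alpha)))$. (4) $\mathrm{let}\ x=M_1\ \mathrm{in}\ M_2$: $(K_1,S_1,\tau_1)=\mathcal{W}(K,T,M_1)$; $(K'_1,\sigma)=\mathrm{Cls}(K_1,S_1(T),\tau_1)$; $(K_2,S_2,\tau_2)=\mathcal{W}(K'_1,S_1(T)\{x:\sigma\},M_2)$; return $(K_2,S_2\circ S_1,\tau_2)$.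 (5) $\{l_1=M_1,\dots,l_n=M_n\}$: $(K_1,S_1,\tau_1)=\mathcal{W}(K,T,M_1)$, $(K_i,S_i,\tau_i)=\mathcal{W}(K_{i-1},S_{i-1}\circ\cdots\circ S_1(T),M_i)$ ($2\le i\le n$); return $(K_n,S_n\circ\cdots\circ S_1,\{l_1:\mathrm{nf}(S_n\circ\cdots\circ S_2(\tau_1)),\dots,l_i:\mathrm{nf}(S_n\circ\cdots\circ S_{i+1}(\tau_i)),\dots,l_n:\tau_n\})$. (6) $M.l$: $(K_1,S_1,\tau_1)=\mathcal{W}(K,T,M)$; $(K_2,S_2)=\mathcal{U}(K_1\{\alpha_1::\mathcal{U},\alpha_2::\{\!\{l:\alpha_1\|\}\!\}\},\{(\alpha_2,\tau_1)\})$; return $(K_2,S_2\circ S_1,\mathrm{nf}(S_2(\alpha_1)))$. (7) $\mathrm{modify}(M_1,l,M_2)$: $(K_1,S_1,\tau_1)=\mathcal{W}(K,T,M_1)$; $(K_2,S_2,\tau_2)=\mathcal{W}(K_1,S_1(T),M_2)$; $(K_3,S_3)=\mathcal{U}(K_2\{\alpha_1::\mathcal{U},\alpha_2::\{\!\{l:\alpha_1\|\}\!\}\},\{(\alpha_1,\tau_2),(\alpha_2,S_2(\tau_1))\})$; return $(K_3,S_3\circ S_2\circ S_1,\mathrm{nf}(S_3(\alpha_2)))$. (8) $M\setminus l$: as (6) but return $(K_2,S_2\circ S_1,\mathrm{nf}(S_2(\alpha_2-\{l:\alpha_1\})))$. (9) $\mathrm{extend}(M_1,l,M_2)$: $(K_1,S_1,\tau_1)$,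 $(K_2,S_2,\tau_2)$ as in (7); fail if $\mathrm{base}(\tau_1)\in\mathrm{FTV}(\tau_2)$; else $(K_3,S_3)=\mathcal{U}(K_2\{\alpha_1::\mathcal{U},\alpha_2::\{\!\{\|l:\alpha_1\}\!\}\},\{(\alpha_1,\tau_2),(\alpha_2,S_2(\tau_1))\})$; return $(K_3,S_3\circ S_2\circ S_1,\mathrm{nf}(S_3(\alpha_2+\{l:\alpha_1\})))$. -}

module Defs where

open import Data.Nat using (ℕ)
open import Data.Nat.Properties using (_≟_)
open import Data.Bool using (if_then_else_)
open import Data.List using (List; []; _∷_; _++_; map; [_]; length; filter; concatMap)
open import Data.List.Membership.Propositional using (_∈_; _∉_)
open import Data.List.Relation.Binary.Permutation.Propositional using (_↭_)
open import Data.List.Relation.Unary.All using (All)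
open import Data.List.Relation.Unary.Unique.Propositional using (Unique)
open import Data.Product using (_×_; _,_; ∃; proj₁; proj₂)
open import Relation.Nullary using (¬_; ¬?; does)
open import Relation.Binary.PropositionalEquality using (_≡_; _≢_)
open import Relation.Binary.Construct.Closure.ReflexiveTransitive using (Star)

TyVar : Set
TyVar = ℕ

Label : Set
Label = ℕ

BaseTy : Set
BaseTy = ℕ

Var : Set
Var = ℕ

Const : Set
Const = ℕ

-- Monotypes.  τ ::= b | ρ | τ → τ ;  ρ ::= α | {l₁:τ₁,…} | ρ+{l:τ} | ρ-{l:τ}.
-- The two syntactic categories are merged into one datatype
-- ('op plus ρ l τ' is ρ+{l:τ}, 'op minus ρ l τ' is ρ-{l:τ}).

data Sign : Set where
  plus minus : Sign

data Ty : Set where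
  base : BaseTy → Ty
  tvar : TyVar → Ty
  rcd  : List (Label × Ty) → Ty
  _⇒_  : Ty → Ty → Ty
  op   : Sign → Ty → Label → Ty → Ty

infixr 5 _⇒_

Fields : Set
Fields = List (Label × Ty)

labels : Fields → List Label
labels = map proj₁

Ops : Set
Ops = List (Sign × Label × Ty)

chain : Ty → Ops → Ty
chain ρ [] = ρ
chain ρ ((s , l , t) ∷ os) = chain (op s ρ l t) os

opLabels : Ops → List Label
opLabels = map (λ o → proj₁ (proj₂ o))

plusLabels : Ops → List Label
plusLabels [] = []
plusLabels ((plus , l , _) ∷ os) = l ∷ plusLabels os
plusLabels ((minus , _ , _) ∷ os) = plusLabels os

minusLabels : Ops → List Label
minusLabels [] = []
minusLabels ((minus , l , _) ∷ os) = l ∷ minusLabels os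
minusLabels ((plus , _ , _) ∷ os) = minusLabels os

baseOf : Ty → Ty
baseOf (op s ρ l t) = baseOf ρ
baseOf t = t

mutual
  ftv : Ty → List TyVar
  ftv (base b) = []
  ftv (tvar α) = α ∷ []
  ftv (rcd fs) = ftvF fs
  ftv (t ⇒ u) = ftv t ++ ftv u
  ftv (op s ρ l t) = ftv ρ ++ ftv t

  ftvF : Fields → List TyVar
  ftvF [] = []
  ftvF ((l , t) ∷ fs) = ftv t ++ ftvF fs

Subst : Set
Subst = TyVar → Ty

mutual
  sub : Subst → Ty → Ty
  sub S (base b) = base b
  sub S (tvar α) = S α
  sub S (rcd fs) = rcd (subF S fs)
  sub S (t ⇒ u) = sub S t ⇒ sub S u
  sub S (op s ρ l t) = op s (sub S ρ) l (sub S t)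

  subF : Subst → Fields → Fields
  subF S [] = []
  subF S ((l , t) ∷ fs) = (l , sub S t) ∷ subF S fs

idS : Subst
idS = tvar

_∘S_ : Subst → Subst → Subst
(S₁ ∘S S₂) α = sub S₁ (S₂ α)

infixr 9 _∘S_

update : Subst → TyVar → Ty → Subst
update S α t β = if does (β ≟ α) then t else S β

renameS : List TyVar → List TyVar → Subst
renameS (α ∷ αs) (β ∷ βs) = update (renameS αs βs) α (tvar β)
renameS _ _ = tvar

data Kind : Set where
  𝒰  : Kind
  rk : Fields → Fields → Kind   -- {{ present ‖ absent }}

subK : Subst → Kind → Kind
subK S 𝒰 = 𝒰
subK S (rk L R) = rk (subF S L) (subF S R)

ftvK : Kind → List TyVar
ftvK 𝒰 = []
ftvK (rk L R) = ftvF L ++ ftvF R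

-- a kind assignment is a finite map, represented as a list of bindings;
-- K{α::k} is written (α , k) ∷ K together with the side condition α ∉ dom K.
KAsg : Set
KAsg = List (TyVar × Kind)

dom : KAsg → List TyVar
dom = map proj₁

data Poly : Set where
  mono : Ty → Poly
  ∀′   : TyVar → Kind → Poly → Poly

quant : List (TyVar × Kind) → Ty → Poly
quant [] t = mono t
quant ((α , k) ∷ bs) t = ∀′ α k (quant bs t)

ftvP : Poly → List TyVar
ftvP (mono t) = ftv t
ftvP (∀′ α k σ) = ftvK k ++ filter (λ β → ¬? (β ≟ α)) (ftvP σ)

-- substitution on polytypes (bound variables are not substituted;
-- Barendregt convention: bound variables are assumed not to clash)
subP : Subst → Poly → Poly
subP S (mono t) = mono (sub S t)
subP S (∀′ α k σ) = ∀′ α (subK S k) (subP (update S α (tvar α)) σ)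

TAsg : Set
TAsg = List (Var × Poly)

domT : TAsg → List Var
domT = map proj₁

subT : Subst → TAsg → TAsg
subT S [] = []
subT S ((x , σ) ∷ T) = (x , subP S σ) ∷ subT S T

ftvT : TAsg → List TyVar
ftvT = concatMap (λ p → ftvP (proj₂ p))

data InEFTV (K : KAsg) (vs : List TyVar) : TyVar → Set where
  eftv-here : ∀ {α} → α ∈ vs → InEFTV K vs α
  eftv-step : ∀ {α β k} → InEFTV K vs β → (β , k) ∈ K → α ∈ ftvK k →
              InEFTV K vs α

record Cls (K : KAsg) (T : TAsg) (τ : Ty) (K' : KAsg) (σ : Poly) : Set where
  field
    bs       : List (TyVar × Kind)
    split    : K ↭ (bs ++ K')
    distinct : Unique (dom bs)
    disjoint : All (λ α → α ∉ dom K') (dom bs)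
    gen⇒     : ∀ α → α ∈ dom bs → InEFTV K (ftv τ) α × ¬ InEFTV K (ftvT T) α
    gen⇐     : ∀ α → InEFTV K (ftv τ) α → ¬ InEFTV K (ftvT T) α → α ∈ dom bs
    shape    : σ ≡ quant bs τ

infix 4 _≈_ _↝_

data _≈_ : Ty → Ty → Set where
  ≈refl  : ∀ {t} → t ≈ t
  ≈sym   : ∀ {t u} → t ≈ u → u ≈ t
  ≈trans : ∀ {t u v} → t ≈ u → u ≈ v → t ≈ v
  ≈⇒     : ∀ {t t' u u'} → t ≈ t' → u ≈ u' → (t ⇒ u) ≈ (t' ⇒ u')
  ≈op    : ∀ {s ρ ρ' l t t'} → ρ ≈ ρ' → t ≈ t' → op s ρ l t ≈ op s ρ' l t'
  ≈fld   : ∀ {fs gs l t t'} → t ≈ t' →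
           rcd (fs ++ (l , t) ∷ gs) ≈ rcd (fs ++ (l , t') ∷ gs)
  ≈perm  : ∀ {fs gs} → fs ↭ gs → rcd fs ≈ rcd gs
  ≈swap  : ∀ {s s' ρ l l' t t'} → l ≢ l' →
           op s (op s' ρ l' t') l t ≈ op s' (op s ρ l t) l' t'

data _↝_ : Ty → Ty → Set where
  r-del : ∀ {fs gs os l t} → l ∉ opLabels os →
          op minus (chain (rcd (fs ++ (l , t) ∷ gs)) os) l t ↝ chain (rcd (fs ++ gs)) os
  r-ext : ∀ {fs os l t} → l ∉ labels fs → l ∉ opLabels os →
          op plus (chain (rcd fs) os) l t ↝ chain (rcd (fs ++ [ (l , t) ])) os
  -- (iii) α ⋯ -ᵢ{l:τ} ⋯ +ⱼ{l:τ} → α ⋯ ⋯   (i, j first occurrences)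
  r-mp  : ∀ {α os₁ os₂ l t} → l ∉ opLabels os₁ → l ∉ plusLabels os₂ →
          op plus (chain (op minus (chain (tvar α) os₁) l t) os₂) l t ↝ chain (chain (tvar α) os₁) os₂
  -- (iv) α ⋯ +ᵢ{l:τ} ⋯ -ⱼ{l:τ} → α ⋯ ⋯   (i, j first occurrences)
  r-pm  : ∀ {α os₁ os₂ l t} → l ∉ opLabels os₁ → l ∉ minusLabels os₂ →
          op minus (chain (op plus (chain (tvar α) os₁) l t) os₂) l t ↝ chain (chain (tvar α) os₁) os₂
  c-⇒ˡ  : ∀ {t t' u} → t ↝ t' → (t ⇒ u) ↝ (t' ⇒ u)
  c-⇒ʳ  : ∀ {t u u'} → u ↝ u' → (t ⇒ u) ↝ (t ⇒ u')
  c-opˡ : ∀ {s ρ ρ' l t} → ρ ↝ ρ' → op s ρ l t ↝ op s ρ' l t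
  c-opʳ : ∀ {s ρ l t t'} → t ↝ t' → op s ρ l t ↝ op s ρ l t'
  c-fld : ∀ {fs gs l t t'} → t ↝ t' →
          rcd (fs ++ (l , t) ∷ gs) ↝ rcd (fs ++ (l , t') ∷ gs)

Step : Ty → Ty → Set
Step τ τ' = ∃ λ σ → ∃ λ σ' → τ ≈ σ × σ ↝ σ' × σ' ≈ τ'

NormalForm : Ty → Set
NormalForm τ = ∀ τ' → ¬ Step τ τ'

IsNF : Ty → Ty → Set
IsNF τ τ' = Star Step τ τ' × NormalForm τ'

data Term : Set where
  var    : Var → Term
  con    : Const → BaseTy → Term
  lam    : Var → Term → Term
  app    : Term → Term → Term
  let′   : Var → Term → Term → Term
  rec    : List (Label × Term) → Term
  sel    : Term → Label → Term
  modify : Term → Label → Term → Term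
  remove : Term → Label → Term
  extend : Term → Label → Term → Term

-- The unification algorithm 𝒰(K,E) is treated as an arbitrary relation:
-- Unifier-rel K E K' S  means  𝒰(K,E) = (K',S).

Unifier : Set₁
Unifier = KAsg → List (Ty × Ty) → KAsg → Subst → Set

-- Algorithm 𝒲 as a relation:  W 𝒰 K T M K' S τ  means  𝒲(K,T,M) = (K',S,τ)
-- (for some choice of the fresh variables).

newBindings : Subst → List TyVar → List (TyVar × Kind) → KAsg
newBindings S (β ∷ βs) ((α , k) ∷ bs) = (β , subK S k) ∷ newBindings S βs bs
newBindings S _ _ = []

module Algorithm (U : Unifier) where

  mutual
    data W : KAsg → TAsg → Term → KAsg → Subst → Ty → Set where
      W-var : ∀ {K T x bs τ τ'} (βs : List TyVar) →
              (x , quant bs τ) ∈ T →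
              length βs ≡ length bs → Unique βs → All (λ β → β ∉ dom K) βs →
              IsNF (sub (renameS (dom bs) βs) τ) τ' →
              W K T (var x)
                (newBindings (renameS (dom bs) βs) βs bs ++ K) idS τ'
      W-con : ∀ {K T c b} → W K T (con c b) K idS (base b)
      W-lam : ∀ {K T x M α K₁ S₁ τ₁ τ} →
              α ∉ dom K → x ∉ domT T →
              W ((α , 𝒰) ∷ K) ((x , mono (tvar α)) ∷ T) M K₁ S₁ τ₁ →
              IsNF (S₁ α) τ →
              W K T (lam x M) K₁ S₁ (τ ⇒ τ₁)
      W-app : ∀ {K T M₁ M₂ K₁ S₁ τ₁ K₂ S₂ τ₂ α K₃ S₃ τ} →
              W K T M₁ K₁ S₁ τ₁ →
              W K₁ (subT S₁ T) M₂ K₂ S₂ τ₂ →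
              α ∉ dom K₂ →
              U ((α , 𝒰) ∷ K₂) [ (sub S₂ τ₁ , τ₂ ⇒ tvar α) ] K₃ S₃ →
              IsNF (S₃ α) τ →
              W K T (app M₁ M₂) K₃ (S₃ ∘S S₂ ∘S S₁) τ
      W-let : ∀ {K T x M₁ M₂ K₁ S₁ τ₁ K₁' σ K₂ S₂ τ₂} →
              W K T M₁ K₁ S₁ τ₁ →
              Cls K₁ (subT S₁ T) τ₁ K₁' σ →
              x ∉ domT (subT S₁ T) →
              W K₁' ((x , σ) ∷ subT S₁ T) M₂ K₂ S₂ τ₂ →
              W K T (let′ x M₁ M₂) K₂ (S₂ ∘S S₁) τ₂
      W-rec : ∀ {K T fs K' S fts} →
              WR K T fs K' S fts →
              W K T (rec fs) K' S (rcd fts)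
      W-sel : ∀ {K T M l K₁ S₁ τ₁ α₁ α₂ K₂ S₂ τ} →
              W K T M K₁ S₁ τ₁ →
              α₁ ∉ dom K₁ → α₂ ∉ dom K₁ → α₁ ≢ α₂ →
              U ((α₂ , rk [ (l , tvar α₁) ] []) ∷ (α₁ , 𝒰) ∷ K₁)
                [ (tvar α₂ , τ₁) ] K₂ S₂ →
              IsNF (S₂ α₁) τ →
              W K T (sel M l) K₂ (S₂ ∘S S₁) τ
      W-modify : ∀ {K T M₁ l M₂ K₁ S₁ τ₁ K₂ S₂ τ₂ α₁ α₂ K₃ S₃ τ} →
              W K T M₁ K₁ S₁ τ₁ →
              W K₁ (subT S₁ T) M₂ K₂ S₂ τ₂ →
              α₁ ∉ dom K₂ → α₂ ∉ dom K₂ → α₁ ≢ α₂ →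
              U ((α₂ , rk [ (l , tvar α₁) ] []) ∷ (α₁ , 𝒰) ∷ K₂)
                ((tvar α₁ , τ₂) ∷ (tvar α₂ , sub S₂ τ₁) ∷ []) K₃ S₃ →
              IsNF (S₃ α₂) τ →
              W K T (modify M₁ l M₂) K₃ (S₃ ∘S S₂ ∘S S₁) τ
      W-remove : ∀ {K T M l K₁ S₁ τ₁ α₁ α₂ K₂ S₂ τ} →
              W K T M K₁ S₁ τ₁ →
              α₁ ∉ dom K₁ → α₂ ∉ dom K₁ → α₁ ≢ α₂ →
              U ((α₂ , rk [ (l , tvar α₁) ] []) ∷ (α₁ , 𝒰) ∷ K₁)
                [ (tvar α₂ , τ₁) ] K₂ S₂ →
              IsNF (sub S₂ (op minus (tvar α₂) l (tvar α₁))) τ →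
              W K T (remove M l) K₂ (S₂ ∘S S₁) τ
      W-extend : ∀ {K T M₁ l M₂ K₁ S₁ τ₁ K₂ S₂ τ₂ α₁ α₂ K₃ S₃ τ} →
              W K T M₁ K₁ S₁ τ₁ →
              W K₁ (subT S₁ T) M₂ K₂ S₂ τ₂ →
              (∀ β → baseOf τ₁ ≡ tvar β → β ∉ ftv τ₂) →
              α₁ ∉ dom K₂ → α₂ ∉ dom K₂ → α₁ ≢ α₂ →
              U ((α₂ , rk [] [ (l , tvar α₁) ]) ∷ (α₁ , 𝒰) ∷ K₂)
                ((tvar α₁ , τ₂) ∷ (tvar α₂ , sub S₂ τ₁) ∷ []) K₃ S₃ →
              IsNF (sub S₃ (op plus (tvar α₂) l (tvar α₁))) τ →
              W K T (extend M₁ l M₂) K₃ (S₃ ∘S S₂ ∘S S₁) τ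

    data WR : KAsg → TAsg → List (Label × Term) → KAsg → Subst → Fields → Set where
      WR-nil  : ∀ {K T} → WR K T [] K idS []
      WR-one  : ∀ {K T l M K₁ S₁ τ₁} →
                W K T M K₁ S₁ τ₁ →
                WR K T [ (l , M) ] K₁ S₁ [ (l , τ₁) ]
      WR-cons : ∀ {K T l M l' M' fs K₁ S₁ τ₁ K₂ S₂ fts τ} →
                W K T M K₁ S₁ τ₁ →
                WR K₁ (subT S₁ T) ((l' , M') ∷ fs) K₂ S₂ fts →
                IsNF (sub S₂ τ₁) τ →
                WR K T ((l , M) ∷ (l' , M') ∷ fs) K₂ (S₂ ∘S S₁) ((l , τ) ∷ fts)

-- Every clause of 𝒲 either returns a type of the form nf(…), or assembles a
-- base, arrow or record type from types returned by recursive calls.  Such a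
-- type is normal once its components are: the rewrite rules (i)–(iv) only
-- fire at an operation ±{l:τ}, and type equality never changes a base, arrow
-- or record head into an operation.
module Submission where

open import Defs
open import Data.List using (_++_; _∷_; [])
open import Data.List.Relation.Unary.All using (All; _∷_; []; head; tail)
open import Data.List.Relation.Unary.All.Properties using (++⁺; ++⁻ˡ; ++⁻ʳ)
open import Data.List.Relation.Binary.Permutation.Propositional using (↭-sym)
open import Data.List.Relation.Binary.Permutation.Propositional.Properties using (All-resp-↭)
open import Data.Product using (_×_; _,_; proj₁; proj₂)
open import Function using (id; _∘_)
open import Relation.Nullary using (¬_)

normalForm-resp-≈ : ∀ {t u} → t ≈ u → NormalForm t → NormalForm u
normalForm-resp-≈ t≈u nf-t v (σ , σ' , u≈σ , σ↝σ' , σ'≈v) =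
  nf-t v (σ , σ' , ≈trans t≈u u≈σ , σ↝σ' , σ'≈v)

normalForm-irreducible : ∀ {t t'} → NormalForm t → ¬ (t ↝ t')
normalForm-irreducible nf-t t↝t' = nf-t _ (_ , _ , ≈refl , t↝t' , ≈refl)

AllNormal : Fields → Set
AllNormal = All (NormalForm ∘ proj₂)

allNormal-middle : ∀ fs {gs l t} → AllNormal (fs ++ (l , t) ∷ gs) → NormalForm t
allNormal-middle fs = head ∘ ++⁻ʳ fs

allNormal-replace : ∀ fs {gs l t t'} → (NormalForm t → NormalForm t') →
                    AllNormal (fs ++ (l , t) ∷ gs) → AllNormal (fs ++ (l , t') ∷ gs)
allNormal-replace fs f all = ++⁺ (++⁻ˡ fs all) (f (head rest) ∷ tail rest)
  where rest = ++⁻ʳ fs all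

-- No rewrite rule applies at the root of these types.
data RigidNormal : Ty → Set where
  base : ∀ b → RigidNormal (base b)
  _⇒_  : ∀ {a c} → NormalForm a → NormalForm c → RigidNormal (a ⇒ c)
  rcd  : ∀ {fs} → AllNormal fs → RigidNormal (rcd fs)

rigidNormal-resp-≈ : ∀ {t u} → t ≈ u →
                     (RigidNormal t → RigidNormal u) × (RigidNormal u → RigidNormal t)
rigidNormal-resp-≈ ≈refl = id , id
rigidNormal-resp-≈ (≈sym e) with rigidNormal-resp-≈ e
... | to , from = from , to
rigidNormal-resp-≈ (≈trans e f) with rigidNormal-resp-≈ e | rigidNormal-resp-≈ f
... | to₁ , from₁ | to₂ , from₂ = to₂ ∘ to₁ , from₁ ∘ from₂
rigidNormal-resp-≈ (≈⇒ e f) =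
  (λ { (na ⇒ nc) → normalForm-resp-≈ e na ⇒ normalForm-resp-≈ f nc }) ,
  (λ { (na ⇒ nc) → normalForm-resp-≈ (≈sym e) na ⇒ normalForm-resp-≈ (≈sym f) nc })
rigidNormal-resp-≈ (≈op _ _) = (λ ()) , (λ ())
rigidNormal-resp-≈ (≈fld {fs} e) =
  (λ { (rcd all) → rcd (allNormal-replace fs (normalForm-resp-≈ e) all) }) ,
  (λ { (rcd all) → rcd (allNormal-replace fs (normalForm-resp-≈ (≈sym e)) all) })
rigidNormal-resp-≈ (≈perm p) =
  (λ { (rcd all) → rcd (All-resp-↭ p all) }) ,
  (λ { (rcd all) → rcd (All-resp-↭ (↭-sym p) all) })
rigidNormal-resp-≈ (≈swap _) = (λ ()) , (λ ())

rigidNormal-irreducible : ∀ {t t'} → RigidNormal t → ¬ (t ↝ t')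
rigidNormal-irreducible (na ⇒ _)  (c-⇒ˡ r)      = normalForm-irreducible na r
rigidNormal-irreducible (_ ⇒ nc)  (c-⇒ʳ r)      = normalForm-irreducible nc r
rigidNormal-irreducible (rcd all) (c-fld {fs} r) =
  normalForm-irreducible (allNormal-middle fs all) r

rigidNormal⇒normalForm : ∀ {t} → RigidNormal t → NormalForm t
rigidNormal⇒normalForm rn _ (σ , _ , t≈σ , σ↝σ' , _) =
  rigidNormal-irreducible (proj₁ (rigidNormal-resp-≈ t≈σ) rn) σ↝σ'

module _ (U : Unifier) where
  open Algorithm U

  mutual
    W-normal : ∀ {K T M K' S τ} → W K T M K' S τ → NormalForm τ
    W-normal (W-var _ _ _ _ _ (_ , nf))          = nf
    W-normal W-con                               = rigidNormal⇒normalForm (base _)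
    W-normal (W-lam _ _ w (_ , nf))              = rigidNormal⇒normalForm (nf ⇒ W-normal w)
    W-normal (W-app _ _ _ _ (_ , nf))            = nf
    W-normal (W-let _ _ _ w)                     = W-normal w
    W-normal (W-rec wr)                          = rigidNormal⇒normalForm (rcd (WR-normal wr))
    W-normal (W-sel _ _ _ _ _ (_ , nf))          = nf
    W-normal (W-modify _ _ _ _ _ _ (_ , nf))     = nf
    W-normal (W-remove _ _ _ _ _ (_ , nf))       = nf
    W-normal (W-extend _ _ _ _ _ _ _ (_ , nf))   = nf

    WR-normal : ∀ {K T fs K' S fts} → WR K T fs K' S fts → AllNormal fts
    WR-normal WR-nil                 = []
    WR-normal (WR-one w)             = W-normal w ∷ []
    WR-normal (WR-cons _ wr (_ , nf))  = nf ∷ WR-normal wr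

mainTheorem9 : (U : Unifier) (K : KAsg) (T : TAsg) (M : Term) (K' : KAsg) (S : Subst) (τ : Ty) →
    Algorithm.W U K T M K' S τ → NormalForm τ
mainTheorem9 U _ _ _ _ _ _ = W-normal U
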